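{- Let $k\ge 2$ and $G=\Theta(2,2,2k)$ with end vertices $u$ and $v$. If $m\ge 3$ and $L$ is an $m$-assignment for $G$ with $L(u)=L(v)$, then $P(G,L)\ge P(G,m)$.
   Context: $\Theta(l_1,l_2,l_3)$ is the graph of two end vertices joined by three internally disjoint paths of lengths $l_1,l_2,l_3$. An $m$-assignment $L$ gives each vertex a set of $m$ colors; $P(G,L)$ is the number of proper colorings $f$ of $G$ with $f(w)\in L(w)$ for all $w$; $P(G,m)$ is the chromatic polynomial. -}

module Defs where

open import Data.Nat using (ℕ; zero; suc; _+_; _∸_; _≟_)
open import Data.Product using (_×_; _,_; proj₁; proj₂)
open import Data.List using (List; []; _∷_; _++_; map; concatMap; filter; length; upTo)
open import Data.List.Relation.Unary.All using (All; all?)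
open import Data.List.Relation.Unary.Unique.Propositional using (Unique)
open import Data.List.Membership.Propositional using (_∈_)
open import Data.Vec using (Vec; []; _∷_; replicate)
open import Relation.Binary.PropositionalEquality using (_≡_; _≢_)
open import Relation.Nullary using (Dec; ¬?)
open import Data.Unit using (⊤)

-- A finite (multi)graph on vertices 0,1,...,n-1 given by its edge list.
record Graph : Set where
  constructor mkGraph
  field
    nV    : ℕ
    edges : List (ℕ × ℕ)
open Graph public

chain : ℕ → ℕ → List (ℕ × ℕ)
chain s zero    = []
chain s (suc j) = (s , suc s) ∷ chain (suc s) j

-- Edges of a path of length l from u = 0 to v = 1 whose l-1 internal
-- vertices are s, s+1, ..., s+l-2.
pathEdges : ℕ → ℕ → List (ℕ × ℕ)
pathEdges s zero          = []
pathEdges s (suc zero)    = (0 , 1) ∷ []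
pathEdges s (suc (suc j)) = (0 , s) ∷ (chain s j ++ ((s + j , 1) ∷ []))

-- Number of vertices of Θ(l₁,l₂,l₃): two end vertices plus internal ones.
thetaN : ℕ → ℕ → ℕ → ℕ
thetaN l₁ l₂ l₃ = suc (suc ((l₁ ∸ 1) + (l₂ ∸ 1) + (l₃ ∸ 1)))

-- Θ(l₁,l₂,l₃): end vertices u = 0 and v = 1; the internal vertices of
-- the three paths are numbered consecutively from 2.
Θ : ℕ → ℕ → ℕ → Graph
Θ l₁ l₂ l₃ = mkGraph (thetaN l₁ l₂ l₃)
  (pathEdges 2 l₁ ++ (pathEdges (2 + (l₁ ∸ 1)) l₂
     ++ pathEdges (2 + (l₁ ∸ 1) + (l₂ ∸ 1)) l₃))

at : ∀ {n} → Vec ℕ n → ℕ → ℕ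
at []       _       = 0
at (x ∷ xs) zero    = x
at (x ∷ xs) (suc i) = at xs i

Proper : ∀ {n} → List (ℕ × ℕ) → Vec ℕ n → Set
Proper E c = All (λ e → at c (proj₁ e) ≢ at c (proj₂ e)) E

proper? : ∀ {n} (E : List (ℕ × ℕ)) (c : Vec ℕ n) → Dec (Proper E c)
proper? E c = all? (λ e → ¬? (at c (proj₁ e) ≟ at c (proj₂ e))) E

choices : ∀ {n} → Vec (List ℕ) n → List (Vec ℕ n)
choices []       = [] ∷ []
choices (A ∷ As) = concatMap (λ a → map (a ∷_) (choices As)) A

IsAssignment : ∀ {n} → ℕ → Vec (List ℕ) n → Set
IsAssignment m []       = ⊤
IsAssignment m (A ∷ As) = (Unique A × length A ≡ m) × IsAssignment m As

PL : (G : Graph) → Vec (List ℕ) (nV G) → ℕ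
PL G L = length (filter (proper? (edges G)) (choices L))

P : Graph → ℕ → ℕ
P G m = PL G (replicate (nV G) (upTo m))

SameSet : List ℕ → List ℕ → Set
SameSet A B = (∀ c → c ∈ A → c ∈ B) × (∀ c → c ∈ B → c ∈ A)

{-# OPTIONS --safe #-}

-- Write q = m - 2 and colour u, v with a, b. Each middle vertex of a path of length 2 then has at least
-- q + [a = b] colours left, exactly that many for the uniform assignment, and (q + [a = b])² ≥ q² + (2q+1)[a = b].
-- Hence, with N_b(a) the number of L-colourings of the long path with end colours a and b, and L(u) = L(v),
--   P(G,L) ≥ Σ_b Φ(b),   Φ(b) = q² Σ_a N_b(a) + (2q+1) N_b(b),
-- with equality for the uniform assignment, where every Φ(b) equals the same value Φᵤ. Adding the lists of the
-- long path one at a time, the counts N_b dominate their uniform analogues in total, in minimum and in sums over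
-- pairs; following the last three steps gives Φ(b) ≥ Φᵤ, except for m = 3 and k = 2, where one colour may fall
-- short by one, but then every other colour exceeds Φᵤ by one.

module Submission where

open import Defs
open import Data.Nat using (ℕ; zero; suc; _+_; _*_; _≤_; _<_; z≤n; s≤s; _≟_; _≤?_)
open import Data.Nat.Properties
open import Data.Nat.Tactic.RingSolver using (solve-∀)
open import Algebra.Properties.CommutativeSemigroup +-commutativeSemigroup using (interchange)
open import Data.Product using (_×_; _,_; proj₁; proj₂; ∃-syntax)
open import Data.Sum using (_⊎_; inj₁; inj₂)
open import Function using (_∘_)
open import Data.Fin using (zero; suc)
open import Data.List using (List; []; _∷_; _++_; map; filter; length; upTo)
open import Data.List.Properties using (filter-all; filter-notAll; filter-accept; filter-reject; filter-++; length-++; length-upTo)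
open import Data.List.Membership.Propositional using (_∈_; _∉_; find)
open import Data.List.Membership.Propositional.Properties using (∈-filter⁺; ∈-filter⁻)
open import Data.List.Membership.DecPropositional _≟_ using (_∈?_)
open import Data.List.Relation.Binary.Subset.Propositional using (_⊆_)
open import Data.List.Relation.Unary.All as All using (All; []; _∷_; all?)
open import Data.List.Relation.Unary.All.Properties using (All¬⇒¬Any; ¬Any⇒All¬; ¬All⇒Any¬; ++⁻; ++⁺)
open import Data.List.Relation.Unary.AllPairs as AllPairs using (_∷_)
open import Data.List.Relation.Unary.Any as Any using (here; there)
open import Data.List.Relation.Unary.Unique.Propositional using (Unique)
open import Data.List.Relation.Unary.Unique.Propositional.Properties using (filter⁺; upTo⁺)
open import Data.Vec as V using (Vec; []; _∷_; replicate; lookup)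
open import Relation.Binary.PropositionalEquality
open import Relation.Nullary using (Dec; yes; no; ¬_; ¬?; contradiction)
open import Relation.Nullary.Decidable using (_×-dec_)
open import Relation.Unary using (Decidable)

∑ : List ℕ → (ℕ → ℕ) → ℕ
∑ []       f = 0
∑ (x ∷ xs) f = f x + ∑ xs f

syntax ∑ L (λ x → e) = ∑[ x ∈ L ] e

module _ {f g : ℕ → ℕ} where

  ∑-cong : ∀ L → (∀ y → y ∈ L → f y ≡ g y) → ∑ L f ≡ ∑ L g
  ∑-cong []      _ = refl
  ∑-cong (x ∷ L) h = cong₂ _+_ (h x (here refl)) (∑-cong L (λ y → h y ∘ there))

  ∑-mono-≤ : ∀ L → (∀ y → y ∈ L → f y ≤ g y) → ∑ L f ≤ ∑ L g
  ∑-mono-≤ []      _ = z≤n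
  ∑-mono-≤ (x ∷ L) h = +-mono-≤ (h x (here refl)) (∑-mono-≤ L (λ y → h y ∘ there))

  ∑-distrib-+ : ∀ L → ∑[ y ∈ L ] (f y + g y) ≡ ∑ L f + ∑ L g
  ∑-distrib-+ []      = refl
  ∑-distrib-+ (x ∷ L) = trans (cong (f x + g x +_) (∑-distrib-+ L)) (interchange (f x) (g x) _ _)

∑-*ˡ : ∀ c (f : ℕ → ℕ) L → ∑[ y ∈ L ] (c * f y) ≡ c * ∑ L f
∑-*ˡ c f []      = sym (*-zeroʳ c)
∑-*ˡ c f (x ∷ L) = trans (cong (c * f x +_) (∑-*ˡ c f L)) (sym (*-distribˡ-+ c (f x) (∑ L f)))

∑-*ʳ : ∀ c (f : ℕ → ℕ) L → ∑[ y ∈ L ] (f y * c) ≡ ∑ L f * c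
∑-*ʳ c f L = trans (∑-cong L (λ y _ → *-comm (f y) c)) (trans (∑-*ˡ c f L) (*-comm c (∑ L f)))

∑-const : ∀ c (L : List ℕ) → ∑[ _ ∈ L ] c ≡ length L * c
∑-const c []      = refl
∑-const c (x ∷ L) = cong (c +_) (∑-const c L)

∑-comm : ∀ (g : ℕ → ℕ → ℕ) L M → ∑[ x ∈ L ] ∑ M (g x) ≡ ∑[ y ∈ M ] ∑[ x ∈ L ] g x y
∑-comm g []      M = sym (trans (∑-const 0 M) (*-zeroʳ (length M)))
∑-comm g (x ∷ L) M = trans (cong (∑ M (g x) +_) (∑-comm g L M)) (sym (∑-distrib-+ M))

∑-≥-const : ∀ c (f : ℕ → ℕ) L → (∀ y → y ∈ L → c ≤ f y) → length L * c ≤ ∑ L f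
∑-≥-const c f L h = ≤-trans (≤-reflexive (sym (∑-const c L))) (∑-mono-≤ L h)

𝟙 : {P : Set} → Dec P → ℕ
𝟙 (yes _) = 1
𝟙 (no _)  = 0

module _ {P : Set} where

  𝟙-yes : (p : Dec P) → P → 𝟙 p ≡ 1
  𝟙-yes (yes _) _ = refl
  𝟙-yes (no ¬x) x = contradiction x ¬x

  𝟙-no : (p : Dec P) → ¬ P → 𝟙 p ≡ 0
  𝟙-no (yes x) ¬x = contradiction x ¬x
  𝟙-no (no _)  _  = refl

  𝟙+𝟙¬ : (p : Dec P) → 𝟙 p + 𝟙 (¬? p) ≡ 1
  𝟙+𝟙¬ (yes _) = refl
  𝟙+𝟙¬ (no _)  = refl

module _ {P Q : Set} where

  𝟙-cong : (p : Dec P) (q : Dec Q) → (P → Q) → (Q → P) → 𝟙 p ≡ 𝟙 q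
  𝟙-cong (yes _) (yes _) _ _ = refl
  𝟙-cong (yes x) (no ¬y) f _ = contradiction (f x) ¬y
  𝟙-cong (no ¬x) (yes y) _ g = contradiction (g y) ¬x
  𝟙-cong (no _)  (no _)  _ _ = refl

  𝟙-× : (p : Dec P) (q : Dec Q) → 𝟙 (p ×-dec q) ≡ 𝟙 p * 𝟙 q
  𝟙-× (yes _) (yes _) = refl
  𝟙-× (yes _) (no _)  = refl
  𝟙-× (no _)  (yes _) = refl
  𝟙-× (no _)  (no _)  = refl

δ δᶜ : ℕ → ℕ → ℕ
δ  x y = 𝟙 (x ≟ y)
δᶜ x y = 𝟙 (¬? (x ≟ y))

δ-refl : ∀ x → δ x x ≡ 1
δ-refl x = 𝟙-yes (x ≟ x) refl

δ-≢ : ∀ {x y} → x ≢ y → δ x y ≡ 0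
δ-≢ {x} {y} = 𝟙-no (x ≟ y)

δᶜ-refl : ∀ x → δᶜ x x ≡ 0
δᶜ-refl x = 𝟙-no (¬? (x ≟ x)) (λ x≢x → x≢x refl)

δᶜ-≢ : ∀ {x y} → x ≢ y → δᶜ x y ≡ 1
δᶜ-≢ {x} {y} = 𝟙-yes (¬? (x ≟ y))

δ-sym : ∀ x y → δ x y ≡ δ y x
δ-sym x y = 𝟙-cong (x ≟ y) (y ≟ x) sym sym

δᶜ-sym : ∀ x y → δᶜ x y ≡ δᶜ y x
δᶜ-sym x y = 𝟙-cong (¬? (x ≟ y)) (¬? (y ≟ x)) (λ ne → ne ∘ sym) (λ ne → ne ∘ sym)

∉-head : ∀ {x} {L : List ℕ} → Unique (x ∷ L) → x ∉ L
∉-head (x∉L ∷ _) = All¬⇒¬Any x∉L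

∑-δ-∉ : ∀ x (g : ℕ → ℕ) L → x ∉ L → ∑[ y ∈ L ] (δ x y * g y) ≡ 0
∑-δ-∉ x g []      _   = refl
∑-δ-∉ x g (y ∷ L) x∉L rewrite δ-≢ (x∉L ∘ here) = ∑-δ-∉ x g L (x∉L ∘ there)

∑-δ-∈ : ∀ x (g : ℕ → ℕ) L → Unique L → x ∈ L → ∑[ y ∈ L ] (δ x y * g y) ≡ g x
∑-δ-∈ x g (x ∷ L) u (here refl) rewrite δ-refl x | ∑-δ-∉ x g L (∉-head u) =
  trans (+-identityʳ _) (+-identityʳ (g x))
∑-δ-∈ x g (y ∷ L) u@(_ ∷ u′) (there x∈L)
  rewrite δ-≢ (λ x≡y → ∉-head u (subst (_∈ L) x≡y x∈L)) = ∑-δ-∈ x g L u′ x∈L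

without : ℕ → List ℕ → List ℕ
without x = filter (λ y → ¬? (x ≟ y))

∑-δᶜ : ∀ x (f : ℕ → ℕ) L → ∑[ y ∈ L ] (δᶜ x y * f y) ≡ ∑ (without x L) f
∑-δᶜ x f []      = refl
∑-δᶜ x f (y ∷ L) with x ≟ y
... | yes x≡y rewrite filter-reject (λ z → ¬? (x ≟ z)) {xs = L} (λ x≢y → x≢y x≡y) = ∑-δᶜ x f L
... | no x≢y  rewrite filter-accept (λ z → ¬? (x ≟ z)) {xs = L} x≢y =
  cong₂ _+_ (+-identityʳ (f y)) (∑-δᶜ x f L)

without-∉ : ∀ {x} {L : List ℕ} → x ∉ L → without x L ≡ L
without-∉ {L = L} x∉L = filter-all _ (¬Any⇒All¬ L x∉L)

∈-without⁺ : ∀ {x z} {L : List ℕ} → z ∈ L → x ≢ z → z ∈ without x L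
∈-without⁺ {x} = ∈-filter⁺ (λ y → ¬? (x ≟ y))

∈-without⁻ : ∀ {x z} (L : List ℕ) → z ∈ without x L → z ∈ L × x ≢ z
∈-without⁻ {x} L = ∈-filter⁻ (λ y → ¬? (x ≟ y)) {xs = L}

without-unique : ∀ x {L : List ℕ} → Unique L → Unique (without x L)
without-unique x = filter⁺ (λ y → ¬? (x ≟ y))

length-without-∈ : ∀ {x} L → Unique L → x ∈ L → length L ≡ suc (length (without x L))
length-without-∈ {x} (y ∷ L) u x∈ with x ≟ y
... | yes refl rewrite filter-reject (λ z → ¬? (x ≟ z)) {xs = L} (λ x≢x → x≢x refl) =
  cong (suc ∘ length) (sym (without-∉ (∉-head u)))
... | no x≢y rewrite filter-accept (λ z → ¬? (x ≟ z)) {xs = L} x≢y =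
  cong suc (length-without-∈ L (AllPairs.tail u) (Any.tail x≢y x∈))

length-without : ∀ x {L} → Unique L → length L ≤ suc (length (without x L))
length-without x {L} u with x ∈? L
... | yes x∈L = ≤-reflexive (length-without-∈ L u x∈L)
... | no x∉L  = ≤-trans (≤-reflexive (cong length (sym (without-∉ x∉L)))) (n≤1+n _)

Unique-⊆⇒length≤ : ∀ {xs ys : List ℕ} → Unique xs → xs ⊆ ys → length xs ≤ length ys
Unique-⊆⇒length≤ {[]}     _               _   = z≤n
Unique-⊆⇒length≤ {x ∷ xs} {ys} u@(_ ∷ u′) sub = begin
  suc (length xs)                ≤⟨ s≤s (Unique-⊆⇒length≤ u′ sub′) ⟩
  suc (length (without x ys))    ≤⟨ filter-notAll _ ys (Any.map (λ x≡y x≢y → x≢y x≡y) (sub (here refl))) ⟩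
  length ys                      ∎
  where
  open ≤-Reasoning
  sub′ : xs ⊆ without x ys
  sub′ z∈xs = ∈-without⁺ (sub (there z∈xs)) (λ x≡z → ∉-head u (subst (_∈ xs) (sym x≡z) z∈xs))

∃-∉ : ∀ {L L′ : List ℕ} {b} → Unique L → length L′ ≤ length L → b ∈ L′ → b ∉ L →
      ∃[ c ] c ∈ L × c ∉ L′
∃-∉ {L} {L′} {b} u len b∈L′ b∉L with all? (_∈? L′) L
... | no L⊈L′ = find (¬All⇒Any¬ (_∈? L′) L L⊈L′)
... | yes L⊆L′ = contradiction (≤-trans (Unique-⊆⇒length≤ (¬Any⇒All¬ L b∉L ∷ u) sub) len) (<-irrefl refl)
  where
  sub : b ∷ L ⊆ L′
  sub (here refl) = b∈L′
  sub (there c∈L) = All.lookup L⊆L′ c∈L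

-- Colourings of a path from the uniform assignment

-- With m = q + 2 colours, s q t and d q t count the proper colourings of a path with t edges whose end colours are
-- prescribed and equal, resp. distinct; U q t = (q + 1) ^ t counts those with only one end colour prescribed, and
-- μ q t = min (s q t) (d q t) by the profile lemmas below.
s d μ U : ℕ → ℕ → ℕ
s q zero    = 1
s q (suc t) = suc q * d q t
d q zero    = 0
d q (suc t) = s q t + q * d q t
μ q zero    = 0
μ q (suc t) = μ q t + q * d q t
U q t = s q t + suc q * d q t

U-suc : ∀ q t → U q (suc t) ≡ suc q * U q t
U-suc q t = identity q (s q t) (d q t)
  where
  identity : ∀ q s d → suc q * d + suc q * (s + q * d) ≡ suc q * (s + suc q * d)
  identity = solve-∀

EvenProfile OddProfile : ℕ → ℕ → Set
EvenProfile q t = s q t ≡ suc (d q t) × μ q t ≡ d q t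
OddProfile  q t = d q t ≡ suc (s q t) × μ q t ≡ s q t

even⇒odd : ∀ q t → EvenProfile q t → OddProfile q (suc t)
even⇒odd q t (s≡1+d , μ≡d) rewrite s≡1+d | μ≡d = refl , refl

odd⇒even : ∀ q t → OddProfile q t → EvenProfile q (suc t)
odd⇒even q t (d≡1+s , μ≡s) rewrite d≡1+s | μ≡s = identity q (s q t) , refl
  where
  identity : ∀ q s → suc q * suc s ≡ suc (s + q * suc s)
  identity = solve-∀

profile : ∀ q t → EvenProfile q t ⊎ OddProfile q t
profile q zero = inj₁ (refl , refl)
profile q (suc t) with profile q t
... | inj₁ even = inj₂ (even⇒odd q t even)
... | inj₂ odd  = inj₁ (odd⇒even q t odd)

even-profile : ∀ q i → EvenProfile q (2 * i)
even-profile q zero    = refl , refl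
even-profile q (suc i) rewrite +-suc i (i + 0) = odd⇒even q (suc (2 * i)) (even⇒odd q (2 * i) (even-profile q i))

d≤1+μ : ∀ q t → d q t ≤ suc (μ q t)
d≤1+μ q t with profile q t
... | inj₁ (_ , μ≡d) rewrite μ≡d = n≤1+n _
... | inj₂ (d≡1+s , μ≡s) rewrite d≡1+s | μ≡s = ≤-refl

d≤q*d : ∀ n t → d (suc n) t ≤ suc n * d (suc n) t
d≤q*d n t = m≤m+n (d (suc n) t) (n * d (suc n) t)

d-pos : ∀ n t → 1 ≤ d (suc n) (suc t)
d-pos n zero    = s≤s z≤n
d-pos n (suc t) = ≤-trans (≤-trans (d-pos n t) (d≤q*d n (suc t))) (m≤n+m _ (s (suc n) (suc t)))

μ-pos : ∀ n t → 1 ≤ μ (suc n) (suc (suc t))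
μ-pos n t = ≤-trans (≤-trans (d-pos n t) (d≤q*d n (suc t))) (m≤n+m _ (μ (suc n) (suc t)))

2≤d : ∀ n {t} → 1 ≤ t → 2 ≤ d (suc n) (2 + t)
2≤d n {suc t} _ = +-mono-≤ {1} {s (suc n) (2 + t)} {1} {suc n * d (suc n) (2 + t)}
  (≤-trans (d-pos n t) (m≤m+n _ _)) (≤-trans (d-pos n (suc t)) (d≤q*d n (2 + t)))

-- Adding one list to a path

extend hit : List ℕ → (ℕ → ℕ) → ℕ → ℕ
extend L h x = ∑[ y ∈ L ] (δᶜ x y * h y)
hit    L h x = ∑[ y ∈ L ] (δ x y * h y)

extend+hit : ∀ L h x → extend L h x + hit L h x ≡ ∑ L h
extend+hit L h x = trans (sym (∑-distrib-+ L)) (∑-cong L (λ y _ → split y))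
  where
  split : ∀ y → δᶜ x y * h y + δ x y * h y ≡ h y
  split y = begin
    δᶜ x y * h y + δ x y * h y  ≡⟨ sym (*-distribʳ-+ (h y) (δᶜ x y) (δ x y)) ⟩
    (δᶜ x y + δ x y) * h y      ≡⟨ cong (_* h y) (trans (+-comm (δᶜ x y) _) (𝟙+𝟙¬ (x ≟ y))) ⟩
    1 * h y                     ≡⟨ *-identityˡ (h y) ⟩
    h y                         ∎
    where open ≡-Reasoning

extend-∉ : ∀ L h {x} → x ∉ L → extend L h x ≡ ∑ L h
extend-∉ L h {x} x∉L =
  trans (sym (+-identityʳ _)) (trans (cong (extend L h x +_) (sym (∑-δ-∉ x h L x∉L))) (extend+hit L h x))

extend-∈ : ∀ L h {x} → Unique L → x ∈ L → extend L h x + h x ≡ ∑ L h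
extend-∈ L h {x} u x∈L = trans (cong (extend L h x +_) (sym (∑-δ-∈ x h L u x∈L))) (extend+hit L h x)

extend-pair : ∀ L h {c c′} → c ≢ c′ →
              extend L h c + extend L h c′ ≡ ∑ L h + ∑ (without c′ (without c L)) h
extend-pair L h {c} {c′} c≢c′ = begin
  extend L h c + extend L h c′                   ≡⟨ sym (∑-distrib-+ L) ⟩
  ∑[ y ∈ L ] (δᶜ c y * h y + δᶜ c′ y * h y)       ≡⟨ ∑-cong L (λ y _ → split y) ⟩
  ∑[ y ∈ L ] (h y + δᶜ c y * (δᶜ c′ y * h y))     ≡⟨ ∑-distrib-+ L ⟩
  ∑ L h + ∑[ y ∈ L ] (δᶜ c y * (δᶜ c′ y * h y))   ≡⟨ cong (∑ L h +_) (∑-δᶜ c _ L) ⟩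
  ∑ L h + extend (without c L) h c′              ≡⟨ cong (∑ L h +_) (∑-δᶜ c′ h (without c L)) ⟩
  ∑ L h + ∑ (without c′ (without c L)) h         ∎
  where
  open ≡-Reasoning
  split : ∀ y → δᶜ c y * h y + δᶜ c′ y * h y ≡ h y + δᶜ c y * (δᶜ c′ y * h y)
  split y with c ≟ y
  ... | yes refl = cong (_* h c) (δᶜ-≢ (c≢c′ ∘ sym))
  ... | no _     = cong₂ _+_ (+-identityʳ (h y)) (sym (+-identityʳ _))

multiplicity : List ℕ → ℕ → ℕ
multiplicity L′ y = ∑[ x ∈ L′ ] δ x y

multiplicity-as-hit : ∀ L′ y → multiplicity L′ y ≡ hit L′ (λ _ → 1) y
multiplicity-as-hit L′ y = ∑-cong L′ (λ x _ → trans (δ-sym x y) (sym (*-identityʳ (δ y x))))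

multiplicity≤1 : ∀ {L′} y → Unique L′ → multiplicity L′ y ≤ 1
multiplicity≤1 {L′} y u with y ∈? L′
... | yes y∈L′ rewrite multiplicity-as-hit L′ y | ∑-δ-∈ y (λ _ → 1) L′ u y∈L′ = ≤-refl
... | no y∉L′  rewrite multiplicity-as-hit L′ y | ∑-δ-∉ y (λ _ → 1) L′ y∉L′   = z≤n

∑-hit : ∀ L L′ h → ∑[ x ∈ L′ ] hit L h x ≡ ∑[ y ∈ L ] (multiplicity L′ y * h y)
∑-hit L L′ h = trans (∑-comm (λ x y → δ x y * h y) L′ L) (∑-cong L (λ y _ → ∑-*ʳ (h y) (λ x → δ x y) L′))

∑-hit-≤ : ∀ L {L′} h → Unique L′ → ∑[ x ∈ L′ ] hit L h x ≤ ∑ L h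
∑-hit-≤ L {L′} h u′ = ≤-trans (≤-reflexive (∑-hit L L′ h)) (∑-mono-≤ L term≤)
  where
  term≤ : ∀ y → y ∈ L → multiplicity L′ y * h y ≤ h y
  term≤ y _ = ≤-trans (*-monoˡ-≤ (h y) (multiplicity≤1 y u′)) (≤-reflexive (*-identityˡ (h y)))

∑-hit-+-≤ : ∀ L {L′} h {c} → Unique L → Unique L′ → c ∈ L → c ∉ L′ → ∑[ x ∈ L′ ] hit L h x + h c ≤ ∑ L h
∑-hit-+-≤ L {L′} h {c} u u′ c∈L c∉L′ = begin
  ∑[ x ∈ L′ ] hit L h x + h c                  ≡⟨ cong (_+ h c) (∑-hit L L′ h) ⟩
  ∑[ y ∈ L ] (multiplicity L′ y * h y) + h c   ≤⟨ +-monoˡ-≤ (h c) (∑-mono-≤ L (λ y _ → *-monoˡ-≤ (h y) (term≤ y))) ⟩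
  extend L h c + h c                          ≡⟨ extend-∈ L h u c∈L ⟩
  ∑ L h                                       ∎
  where
  open ≤-Reasoning
  term≤ : ∀ y → multiplicity L′ y ≤ δᶜ c y
  term≤ y with c ≟ y
  ... | yes refl = ≤-reflexive (trans (multiplicity-as-hit L′ c) (∑-δ-∉ c _ L′ c∉L′))
  ... | no _     = multiplicity≤1 y u′

∑-extend-≥-+ : ∀ q L L′ h e → length L′ ≡ suc (suc q) →
               ∑[ x ∈ L′ ] hit L h x + e ≤ ∑ L h → suc q * ∑ L h + e ≤ ∑ L′ (extend L h)
∑-extend-≥-+ q L L′ h e len hit+e≤ = +-cancelʳ-≤ H _ _ (begin
  suc q * S + e + H    ≡⟨ +-assoc (suc q * S) e H ⟩
  suc q * S + (e + H)  ≤⟨ +-monoʳ-≤ (suc q * S) (≤-trans (≤-reflexive (+-comm e H)) hit+e≤) ⟩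
  suc q * S + S        ≡⟨ +-comm (suc q * S) S ⟩
  suc (suc q) * S      ≡⟨ cong (_* S) (sym len) ⟩
  length L′ * S        ≡⟨ sym (∑-const S L′) ⟩
  ∑[ x ∈ L′ ] S        ≡⟨ sym (∑-cong L′ (λ x _ → extend+hit L h x)) ⟩
  ∑[ x ∈ L′ ] (extend L h x + hit L h x) ≡⟨ ∑-distrib-+ L′ ⟩
  ∑ L′ (extend L h) + H ∎)
  where
  open ≤-Reasoning
  S = ∑ L h
  H = ∑[ x ∈ L′ ] hit L h x

∑-extend-≥ : ∀ q L {L′} h → Unique L′ → length L′ ≡ suc (suc q) → suc q * ∑ L h ≤ ∑ L′ (extend L h)
∑-extend-≥ q L {L′} h u′ len = ≤-trans (≤-reflexive (sym (+-identityʳ _)))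
  (∑-extend-≥-+ q L L′ h 0 len (≤-trans (≤-reflexive (+-identityʳ _)) (∑-hit-≤ L h u′)))

∑-extend-≥-miss : ∀ q L {L′} h {c} → Unique L → Unique L′ → length L′ ≡ suc (suc q) → c ∈ L → c ∉ L′ →
                  suc q * ∑ L h + h c ≤ ∑ L′ (extend L h)
∑-extend-≥-miss q L {L′} h {c} u u′ len c∈L c∉L′ = ∑-extend-≥-+ q L L′ h (h c) len (∑-hit-+-≤ L h u u′ c∈L c∉L′)

∑-≥-pairwise : ∀ {lo gap} j (f : ℕ → ℕ) K → Unique K → suc j ≤ length K → gap ≤ suc lo →
               (∀ {y} → y ∈ K → lo ≤ f y) →
               (∀ {y y′} → y ∈ K → y′ ∈ K → y ≢ y′ → lo + gap ≤ f y + f y′) →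
               lo + j * gap ≤ ∑ K f
∑-≥-pairwise {lo} {gap} j f (x ∷ K) u (s≤s j≤|K|) gap≤1+lo each pair with gap ≤? f x
... | no fx≱gap =
  +-mono-≤ (each (here refl)) (≤-trans (*-monoˡ-≤ gap j≤|K|) (∑-≥-const gap f K gap≤))
  where
  fx≤lo : f x ≤ lo
  fx≤lo = ≤-pred (≤-trans (≰⇒> fx≱gap) gap≤1+lo)
  gap≤ : ∀ y → y ∈ K → gap ≤ f y
  gap≤ y y∈K = +-cancelˡ-≤ lo gap (f y)
    (≤-trans (pair (here refl) (there y∈K) (λ x≡y → ∉-head u (subst (_∈ K) (sym x≡y) y∈K))) (+-monoˡ-≤ (f y) fx≤lo))
... | yes gap≤fx with j
...   | zero   = ≤-trans (≤-reflexive (+-identityʳ lo)) (≤-trans (each (here refl)) (m≤m+n (f x) _))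
...   | suc j′ = ≤-trans (≤-reflexive (reassoc lo gap (j′ * gap))) (+-mono-≤ gap≤fx
  (∑-≥-pairwise j′ f K (AllPairs.tail u) j≤|K| gap≤1+lo (each ∘ there) (λ m m′ → pair (there m) (there m′))))
  where
  reassoc : ∀ a b c → a + (b + c) ≡ b + (a + c)
  reassoc = solve-∀

AtEnd : ℕ → ℕ → ℕ → List ℕ → (ℕ → ℕ) → Set
AtEnd q b t L h = suc (U q t) ≤ ∑ L h ⊎ b ∉ L ⊎ h b ≡ s q t

-- Lower bounds, all attained by the uniform assignment, for h c = the number of colourings of a path with t edges
-- whose first vertex (with list L) is coloured c and whose last vertex is coloured b.
record PathBounds (q b t : ℕ) (L : List ℕ) (h : ℕ → ℕ) : Set where
  field
    total : U q t ≤ ∑ L h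
    each  : ∀ {c} → c ∈ L → μ q t ≤ h c
    pair  : ∀ {c c′} → c ∈ L → c′ ∈ L → c ≢ c′ → μ q t + d q t ≤ h c + h c′
    pos   : ∀ {c} → c ∈ L → c ≢ b → 1 ≤ h c
    atEnd : AtEnd q b t L h

∑-δᶜ-length : ∀ b L → ∑[ x ∈ L ] δᶜ x b ≡ length (without b L)
∑-δᶜ-length b L = begin
  ∑[ x ∈ L ] δᶜ x b            ≡⟨ ∑-cong L (λ x _ → trans (δᶜ-sym x b) (sym (*-identityʳ (δᶜ b x)))) ⟩
  ∑[ x ∈ L ] (δᶜ b x * 1)      ≡⟨ ∑-δᶜ b (λ _ → 1) L ⟩
  ∑[ _ ∈ without b L ] 1       ≡⟨ ∑-const 1 (without b L) ⟩
  length (without b L) * 1     ≡⟨ *-identityʳ _ ⟩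
  length (without b L)         ∎
  where open ≡-Reasoning

≤-length-without : ∀ {k} x {L} → Unique L → suc k ≤ length L → k ≤ length (without x L)
≤-length-without x u k<|L| = ≤-pred (≤-trans k<|L| (length-without x u))

pathBounds-base : ∀ n b {L} → Unique L → length L ≡ suc (suc (suc n)) → PathBounds (suc n) b 1 L (λ x → δᶜ x b)
pathBounds-base n b {L} u |L| = record
  { total = subst₂ _≤_ (sym (U-1 (suc n))) (sym (∑-δᶜ-length b L)) (≤-length-without b u (≤-reflexive (sym |L|)))
  ; each  = λ _ → ≤-trans (≤-reflexive (*-zeroʳ (suc n))) z≤n
  ; pair  = λ {c} {c′} _ _ c≢c′ → ≤-trans (≤-reflexive (μ+d-1 n)) (one-differs c≢c′)
  ; pos   = λ _ c≢b → ≤-reflexive (sym (δᶜ-≢ c≢b))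
  ; atEnd = atEnd
  }
  where
  U-1 : ∀ q → U q 1 ≡ suc q
  U-1 q = identity q
    where
    identity : ∀ q → suc q * 0 + suc q * (1 + q * 0) ≡ suc q
    identity = solve-∀
  μ+d-1 : ∀ n → μ (suc n) 1 + d (suc n) 1 ≡ 1
  μ+d-1 n = identity (suc n)
    where
    identity : ∀ q → 0 + q * 0 + (1 + q * 0) ≡ 1
    identity = solve-∀
  one-differs : ∀ {c c′} → c ≢ c′ → 1 ≤ δᶜ c b + δᶜ c′ b
  one-differs {c} {c′} c≢c′ with c ≟ b
  ... | yes refl = ≤-reflexive (sym (δᶜ-≢ (c≢c′ ∘ sym)))
  ... | no _     = s≤s z≤n
  atEnd : AtEnd (suc n) b 1 L (λ x → δᶜ x b)
  atEnd with b ∈? L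
  ... | yes _   = inj₂ (inj₂ (trans (δᶜ-refl b) (sym (*-zeroʳ (suc (suc n))))))
  ... | no b∉L  = inj₂ (inj₁ b∉L)

module _ {n b t : ℕ} {L L′ : List ℕ} {h : ℕ → ℕ} (B : PathBounds (suc n) b (suc t) L h)
         (uL : Unique L) (|L| : length L ≡ suc (suc (suc n)))
         (uL′ : Unique L′) (|L′| : length L′ ≡ suc (suc (suc n))) where

  private
    q = suc n
    open PathBounds B

    U≤∑-step : U q (suc (suc t)) ≤ ∑ L′ (extend L h)
    U≤∑-step = ≤-trans (≤-reflexive (U-suc q (suc t))) (≤-trans (*-monoʳ-≤ (suc q) total) (∑-extend-≥ q L h uL′ |L′|))

    strict-step : suc (U q (suc t)) ≤ ∑ L h → suc (U q (suc (suc t))) ≤ ∑ L′ (extend L h)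
    strict-step U<∑ = begin
      suc (U q (suc (suc t)))    ≡⟨ cong suc (U-suc q (suc t)) ⟩
      suc (suc q * U q (suc t))  ≤⟨ s≤s (+-monoʳ-≤ (U q (suc t)) (*-monoʳ-≤ q (n≤1+n _))) ⟩
      suc q * suc (U q (suc t))  ≤⟨ *-monoʳ-≤ (suc q) U<∑ ⟩
      suc q * ∑ L h              ≤⟨ ∑-extend-≥ q L h uL′ |L′| ⟩
      ∑ L′ (extend L h)          ∎
      where open ≤-Reasoning

    each-step : ∀ c → μ q (suc (suc t)) ≤ extend L h c
    each-step c = ≤-trans
      (∑-≥-pairwise q h (without c L) (without-unique c uL) (≤-length-without c uL (≤-reflexive (sym |L|)))
         (d≤1+μ q (suc t)) (each ∘ from) (λ m m′ → pair (from m) (from m′)))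
      (≤-reflexive (sym (∑-δᶜ c h L)))
      where
      from : ∀ {y} → y ∈ without c L → y ∈ L
      from m = proj₁ (∈-without⁻ L m)

    pair-step : ∀ {c c′} → c ≢ c′ → μ q (suc (suc t)) + d q (suc (suc t)) ≤ extend L h c + extend L h c′
    pair-step {c} {c′} c≢c′ = begin
      μ q (suc (suc t)) + d q (suc (suc t))
        ≡⟨ identity n (μ q (suc t)) (s q (suc t)) (d q (suc t)) ⟩
      U q (suc t) + (μ q (suc t) + n * d q (suc t))
        ≤⟨ +-mono-≤ total (∑-≥-pairwise n h K (without-unique c′ (without-unique c uL))
              (≤-length-without c′ (without-unique c uL) (≤-length-without c uL (≤-reflexive (sym |L|))))
              (d≤1+μ q (suc t)) (each ∘ from) (λ m m′ → pair (from m) (from m′))) ⟩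
      ∑ L h + ∑ K h
        ≡⟨ sym (extend-pair L h c≢c′) ⟩
      extend L h c + extend L h c′ ∎
      where
      open ≤-Reasoning
      K = without c′ (without c L)
      from : ∀ {y} → y ∈ K → y ∈ L
      from m = proj₁ (∈-without⁻ L (proj₁ (∈-without⁻ (without c L) m)))
      identity : ∀ n μ s d → μ + suc n * d + (s + suc n * d) ≡ s + suc (suc n) * d + (μ + n * d)
      identity = solve-∀

    atEnd-missing : b ∉ L → AtEnd q b (suc (suc t)) L′ (extend L h)
    atEnd-missing b∉L with b ∈? L′
    ... | no b∉L′  = inj₂ (inj₁ b∉L′)
    ... | yes b∈L′ with ∃-∉ uL (≤-reflexive (trans |L′| (sym |L|))) b∈L′ b∉L
    ...   | c , c∈L , c∉L′ = inj₁ (begin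
      suc (U q (suc (suc t)))        ≡⟨ cong suc (U-suc q (suc t)) ⟩
      suc (suc q * U q (suc t))      ≡⟨ +-comm 1 _ ⟩
      suc q * U q (suc t) + 1        ≤⟨ +-mono-≤ (*-monoʳ-≤ (suc q) total)
                                                  (pos c∈L (λ c≡b → b∉L (subst (_∈ L) c≡b c∈L))) ⟩
      suc q * ∑ L h + h c            ≤⟨ ∑-extend-≥-miss q L h uL uL′ |L′| c∈L c∉L′ ⟩
      ∑ L′ (extend L h)              ∎)
      where open ≤-Reasoning

    extend-at-end : b ∈ L → h b ≡ s q (suc t) → ∑ L h ≡ U q (suc t) → extend L h b ≡ s q (suc (suc t))
    extend-at-end b∈L hb≡s ∑≡U = +-cancelʳ-≡ (s q (suc t)) _ _ (begin
      extend L h b + s q (suc t)           ≡⟨ cong (extend L h b +_) (sym hb≡s) ⟩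
      extend L h b + h b                   ≡⟨ extend-∈ L h uL b∈L ⟩
      ∑ L h                                ≡⟨ ∑≡U ⟩
      s q (suc t) + suc q * d q (suc t)    ≡⟨ +-comm (s q (suc t)) _ ⟩
      s q (suc (suc t)) + s q (suc t)      ∎)
      where open ≡-Reasoning

    atEnd-step : AtEnd q b (suc (suc t)) L′ (extend L h)
    atEnd-step with atEnd | b ∈? L
    ... | inj₁ U<∑          | _       = inj₁ (strict-step U<∑)
    ... | _                 | no b∉L  = atEnd-missing b∉L
    ... | inj₂ (inj₁ b∉L)   | yes b∈L = contradiction b∈L b∉L
    ... | inj₂ (inj₂ hb≡s)  | yes b∈L with suc (U q (suc t)) ≤? ∑ L h
    ...   | yes U<∑ = inj₁ (strict-step U<∑)
    ...   | no U≮∑  = inj₂ (inj₂ (extend-at-end b∈L hb≡s (≤-antisym (≮⇒≥ U≮∑) total)))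

  pathBounds-step : PathBounds q b (suc (suc t)) L′ (extend L h)
  pathBounds-step = record
    { total = U≤∑-step
    ; each  = λ {c} _ → each-step c
    ; pair  = λ _ _ → pair-step
    ; pos   = λ {c} _ _ → ≤-trans (μ-pos n t) (each-step c)
    ; atEnd = atEnd-step
    }

paths : ∀ {t} → ℕ → Vec (List ℕ) t → ℕ → ℕ
paths b []       a = δᶜ a b
paths b (L ∷ Ls) a = extend L (paths b Ls) a

pathBounds : ∀ n b {t} L (Ls : Vec (List ℕ) t) → IsAssignment (suc (suc (suc n))) (L ∷ Ls) →
             PathBounds (suc n) b (suc t) L (paths b Ls)
pathBounds n b L []        ((uL , |L|) , _)    = pathBounds-base n b uL |L|
pathBounds n b L (L′ ∷ Ls) ((uL , |L|) , asg) =
  pathBounds-step (pathBounds n b L′ Ls asg) (proj₁ (proj₁ asg)) (proj₂ (proj₁ asg)) uL |L|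

-- The last three lists of the long path

-- Only in the deficit case does X (both ends coloured b) fall below its uniform value, and then T₃ has a surplus.
data TailCase (q t b : ℕ) (L₁ : List ℕ) (T₁ T₃ X : ℕ) : Set where
  surplus : suc (U q t) ≤ T₁ → suc q * (suc q * T₁) ≤ T₃ → q * T₁ + μ q t ≤ X → TailCase q t b L₁ T₁ T₃ X
  tight   : U q t ≤ T₁ → suc q * (suc q * T₁) ≤ T₃ → q * T₁ + s q t ≤ X → TailCase q t b L₁ T₁ T₃ X
  deficit : b ∉ L₁ → U q t ≤ T₁ → suc q * (suc q * T₁ + μ q t) ≤ T₃ → q * T₁ + μ q t ≤ X →
            TailCase q t b L₁ T₁ T₃ X

suc-*-cancel-≤ : ∀ q T e X → suc q * T + e ≤ X + T → q * T + e ≤ X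
suc-*-cancel-≤ q T e X le =
  +-cancelˡ-≤ T _ _ (≤-trans (≤-reflexive (sym (+-assoc T (q * T) e))) (≤-trans le (≤-reflexive (+-comm X T))))

module _ {q t b : ℕ} {L₁ L₂ A : List ℕ} {g : ℕ → ℕ} (B : PathBounds q b t L₁ g)
         (u₁ : Unique L₁) (|L₁| : length L₁ ≡ suc (suc q))
         (u₂ : Unique L₂) (|L₂| : length L₂ ≡ suc (suc q))
         (uA : Unique A) (|A| : length A ≡ suc (suc q)) where

  private
    open PathBounds B
    h = extend L₁ g
    T₁ = ∑ L₁ g
    T₂ = ∑ L₂ h
    X = extend L₂ h b

    T₁≤T₂ : suc q * T₁ ≤ T₂
    T₁≤T₂ = ∑-extend-≥ q L₁ g u₂ |L₂|

    T₂≤T₃ : suc q * T₂ ≤ ∑ A (extend L₂ h)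
    T₂≤T₃ = ∑-extend-≥ q L₂ h uA |A|

    T₁≤T₃ : suc q * (suc q * T₁) ≤ ∑ A (extend L₂ h)
    T₁≤T₃ = ≤-trans (*-monoʳ-≤ (suc q) T₁≤T₂) T₂≤T₃

    s≤T₁ : s q t ≤ T₁
    s≤T₁ = ≤-trans (m≤m+n (s q t) _) total

    X-both : b ∈ L₂ → b ∈ L₁ → q * T₁ + g b ≤ X
    X-both b∈L₂ b∈L₁ = suc-*-cancel-≤ q T₁ (g b) X (begin
      suc q * T₁ + g b    ≤⟨ +-monoˡ-≤ (g b) T₁≤T₂ ⟩
      T₂ + g b            ≡⟨ cong (_+ g b) (sym (extend-∈ L₂ h u₂ b∈L₂)) ⟩
      X + h b + g b       ≡⟨ +-assoc X (h b) (g b) ⟩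
      X + (h b + g b)     ≡⟨ cong (X +_) (extend-∈ L₁ g u₁ b∈L₁) ⟩
      X + T₁              ∎)
      where open ≤-Reasoning

    deficit-case : b ∈ L₂ → b ∉ L₁ → TailCase q t b L₁ T₁ (∑ A (extend L₂ h)) X
    deficit-case b∈L₂ b∉L₁ with ∃-∉ u₁ (≤-reflexive (trans |L₂| (sym |L₁|))) b∈L₂ b∉L₁
    ... | c , c∈L₁ , c∉L₂ = deficit b∉L₁ total (≤-trans (*-monoʳ-≤ (suc q) T₂≥) T₂≤T₃)
      (suc-*-cancel-≤ q T₁ (μ q t) X (≤-trans T₂≥ (≤-reflexive (sym X+T₁≡T₂))))
      where
      T₂≥ : suc q * T₁ + μ q t ≤ T₂
      T₂≥ = ≤-trans (+-monoʳ-≤ (suc q * T₁) (each c∈L₁)) (∑-extend-≥-miss q L₁ g u₁ u₂ |L₂| c∈L₁ c∉L₂)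
      X+T₁≡T₂ : X + T₁ ≡ T₂
      X+T₁≡T₂ = trans (cong (X +_) (sym (extend-∉ L₁ g b∉L₁))) (extend-∈ L₂ h u₂ b∈L₂)

  tailCase : TailCase q t b L₁ T₁ (∑ A (extend L₂ h)) X
  tailCase with b ∈? L₂
  ... | no b∉L₂ = tight total T₁≤T₃ (begin
    q * T₁ + s q t   ≤⟨ +-monoʳ-≤ (q * T₁) s≤T₁ ⟩
    q * T₁ + T₁      ≡⟨ +-comm (q * T₁) T₁ ⟩
    suc q * T₁       ≤⟨ T₁≤T₂ ⟩
    T₂               ≡⟨ sym (extend-∉ L₂ h b∉L₂) ⟩
    X                ∎)
    where open ≤-Reasoning
  ... | yes b∈L₂ with b ∈? L₁
  ...   | no b∉L₁ = deficit-case b∈L₂ b∉L₁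
  ...   | yes b∈L₁ with atEnd
  ...     | inj₁ U<T₁         = surplus U<T₁ T₁≤T₃ (≤-trans (+-monoʳ-≤ (q * T₁) (each b∈L₁)) (X-both b∈L₂ b∈L₁))
  ...     | inj₂ (inj₁ b∉L₁)  = contradiction b∈L₁ b∉L₁
  ...     | inj₂ (inj₂ gb≡s)  = tight total T₁≤T₃ (subst (λ x → q * T₁ + x ≤ X) gb≡s (X-both b∈L₂ b∈L₁))

-- Φ q b A Ls is the contribution of colour b at v to the lower bound of P(G,L) (see ∑Φ≤PL); Φᵤ q e is its value for
-- the uniform assignment, where the long path has e edges.
Φ : ∀ {t} → ℕ → ℕ → List ℕ → Vec (List ℕ) t → ℕ
Φ q b A Ls = q * q * ∑ A (paths b Ls) + (q + suc q) * paths b Ls b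

Φᵤ : ℕ → ℕ → ℕ
Φᵤ q e = q * q * U q e + (q + suc q) * s q e

Φ-mono : ∀ q {T T′ X X′} → T′ ≤ T → X′ ≤ X → q * q * T′ + (q + suc q) * X′ ≤ q * q * T + (q + suc q) * X
Φ-mono q T′≤T X′≤X = +-mono-≤ (*-monoʳ-≤ (q * q) T′≤T) (*-monoʳ-≤ (q + suc q) X′≤X)

Φᵤ-even : ∀ q t → EvenProfile q (suc t) →
          Φᵤ q (3 + t) ≡ q * q * (suc q * (suc q * U q (suc t))) + (q + suc q) * (q * U q (suc t) + suc (d q (suc t)))
Φᵤ-even q t (s≡1+d , _) = cong₂ (λ u x → q * q * u + (q + suc q) * x) U-eq s-eq
  where
  D = d q (suc t)
  U-eq : U q (3 + t) ≡ suc q * (suc q * U q (suc t))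
  U-eq = trans (U-suc q (2 + t)) (cong (suc q *_) (U-suc q (suc t)))
  identity : ∀ q D → suc q * (suc D + q * D) ≡ q * (suc D + suc q * D) + suc D
  identity = solve-∀
  s-eq : s q (3 + t) ≡ q * U q (suc t) + suc D
  s-eq = begin
    suc q * (s q (suc t) + q * D)   ≡⟨ cong (λ x → suc q * (x + q * D)) s≡1+d ⟩
    suc q * (suc D + q * D)         ≡⟨ identity q D ⟩
    q * (suc D + suc q * D) + suc D ≡⟨ cong (λ x → q * (x + suc q * D) + suc D) (sym s≡1+d) ⟩
    q * U q (suc t) + suc D         ∎
    where open ≡-Reasoning

Φ-deficit : ∀ q Uₜ D {T₃ X} → q + suc q ≤ q * q * (suc q * D) → suc q * (suc q * Uₜ + D) ≤ T₃ → q * Uₜ + D ≤ X →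
            q * q * (suc q * (suc q * Uₜ)) + (q + suc q) * (q * Uₜ + suc D) ≤ q * q * T₃ + (q + suc q) * X
Φ-deficit q Uₜ D {T₃} {X} afford T₃≥ X≥ = begin
  q * q * (suc q * (suc q * Uₜ)) + (q + suc q) * (q * Uₜ + suc D)
    ≡⟨ split q Uₜ D ⟩
  q * q * (suc q * (suc q * Uₜ)) + (q + suc q) + (q + suc q) * (q * Uₜ + D)
    ≤⟨ +-monoˡ-≤ ((q + suc q) * (q * Uₜ + D)) (+-monoʳ-≤ (q * q * (suc q * (suc q * Uₜ))) afford) ⟩
  q * q * (suc q * (suc q * Uₜ)) + q * q * (suc q * D) + (q + suc q) * (q * Uₜ + D)
    ≡⟨ merge q Uₜ D ⟩
  q * q * (suc q * (suc q * Uₜ + D)) + (q + suc q) * (q * Uₜ + D)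
    ≤⟨ Φ-mono q T₃≥ X≥ ⟩
  q * q * T₃ + (q + suc q) * X ∎
  where
  open ≤-Reasoning
  split : ∀ q Uₜ D → q * q * (suc q * (suc q * Uₜ)) + (q + suc q) * (q * Uₜ + suc D)
                  ≡ q * q * (suc q * (suc q * Uₜ)) + (q + suc q) + (q + suc q) * (q * Uₜ + D)
  split = solve-∀
  merge : ∀ q Uₜ D → q * q * (suc q * (suc q * Uₜ)) + q * q * (suc q * D) + (q + suc q) * (q * Uₜ + D)
                  ≡ q * q * (suc q * (suc q * Uₜ + D)) + (q + suc q) * (q * Uₜ + D)
  merge = solve-∀

module _ (n t : ℕ) where

  private
    q = suc n
    Uₜ = U q (suc t)
    D = d q (suc t)

    T₃-bound : ∀ {T₁ T₃} → Uₜ ≤ T₁ → suc q * (suc q * T₁) ≤ T₃ → suc q * (suc q * Uₜ) ≤ T₃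
    T₃-bound Uₜ≤T₁ T₃≥ = ≤-trans (*-monoʳ-≤ (suc q) (*-monoʳ-≤ (suc q) Uₜ≤T₁)) T₃≥

  Φ-≥-tail : ∀ {b L T₁ T₃ X} → EvenProfile q (suc t) → q + suc q ≤ q * q * (suc q * D) →
             TailCase q (suc t) b L T₁ T₃ X →
             q * q * (suc q * (suc q * Uₜ)) + (q + suc q) * (q * Uₜ + suc D) ≤ q * q * T₃ + (q + suc q) * X
  Φ-≥-tail (_ , μ≡d) _ (surplus Uₜ<T₁ T₃≥ X≥) = Φ-mono q (T₃-bound (<⇒≤ Uₜ<T₁) T₃≥) (begin
    q * Uₜ + suc D      ≡⟨ +-suc (q * Uₜ) D ⟩
    suc (q * Uₜ) + D    ≤⟨ +-monoˡ-≤ D (*-monoʳ-< q (n<1+n Uₜ)) ⟩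
    q * suc Uₜ + D      ≤⟨ +-mono-≤ (*-monoʳ-≤ q Uₜ<T₁) (≤-reflexive (sym μ≡d)) ⟩
    _                  ≤⟨ X≥ ⟩
    _                  ∎)
    where open ≤-Reasoning
  Φ-≥-tail (s≡1+d , _) _ (tight Uₜ≤T₁ T₃≥ X≥) =
    Φ-mono q (T₃-bound Uₜ≤T₁ T₃≥) (≤-trans (+-mono-≤ (*-monoʳ-≤ q Uₜ≤T₁) (≤-reflexive (sym s≡1+d))) X≥)
  Φ-≥-tail (_ , μ≡d) afford (deficit _ Uₜ≤T₁ T₃≥ X≥) =
    Φ-deficit q Uₜ D afford
      (≤-trans (*-monoʳ-≤ (suc q) (+-mono-≤ (*-monoʳ-≤ (suc q) Uₜ≤T₁) (≤-reflexive (sym μ≡d)))) T₃≥)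
      (≤-trans (+-mono-≤ (*-monoʳ-≤ q Uₜ≤T₁) (≤-reflexive (sym μ≡d))) X≥)

Φᵤ≤Φ : ∀ n b {t} A L₂ L₁ (rest : Vec (List ℕ) t) → IsAssignment (suc (suc (suc n))) (L₂ ∷ L₁ ∷ rest) →
       Unique A → length A ≡ suc (suc (suc n)) → EvenProfile (suc n) (suc t) →
       suc n + suc (suc n) ≤ suc n * suc n * (suc (suc n) * d (suc n) (suc t)) →
       Φᵤ (suc n) (3 + t) ≤ Φ (suc n) b A (L₂ ∷ L₁ ∷ rest)
Φᵤ≤Φ n b {t} A L₂ L₁ rest ((u₂ , |L₂|) , asg) uA |A| even afford = begin
  Φᵤ (suc n) (3 + t)   ≡⟨ Φᵤ-even (suc n) t even ⟩
  _                    ≤⟨ Φ-≥-tail n t even afford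
                            (tailCase (pathBounds n b L₁ rest asg) (proj₁ (proj₁ asg)) (proj₂ (proj₁ asg))
                                      u₂ |L₂| uA |A|) ⟩
  Φ (suc n) b A (L₂ ∷ L₁ ∷ rest) ∎
  where open ≤-Reasoning

deficit-affordable : ∀ n D → 1 ≤ D → 1 ≤ n ⊎ 2 ≤ D → suc n + suc (suc n) ≤ suc n * suc n * (suc (suc n) * D)
deficit-affordable (suc k) D 1≤D (inj₁ _) =
  ≤-trans (≤-trans (m≤m+n _ _) (≤-reflexive (identity k))) (*-monoʳ-≤ ((2 + k) * (2 + k)) (*-monoʳ-≤ (3 + k) 1≤D))
  where
  identity : ∀ k → 2 + k + (3 + k) + (7 + 14 * k + 7 * (k * k) + k * k * k) ≡ (2 + k) * (2 + k) * ((3 + k) * 1)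
  identity = solve-∀
deficit-affordable n D _ (inj₂ 2≤D) =
  ≤-trans (≤-trans (m≤m+n _ _) (≤-reflexive (identity n))) (*-monoʳ-≤ (suc n * suc n) (*-monoʳ-≤ (2 + n) 2≤D))
  where
  identity : ∀ n → 1 + n + (2 + n) + (1 + 8 * n + 8 * (n * n) + 2 * (n * n * n)) ≡ (1 + n) * (1 + n) * ((2 + n) * 2)
  identity = solve-∀

-- Three colours and k = 2

∑-≥-average : ∀ c (f : ℕ → ℕ) A → Unique A → 2 ≤ length A →
              (∀ {b} → b ∈ A → c ≤ suc (f b)) →
              (∀ {b₀} → b₀ ∈ A → f b₀ < c → ∀ {b} → b ∈ A → b ≢ b₀ → suc c ≤ f b) →
              length A * c ≤ ∑ A f
∑-≥-average c f A u 2≤|A| almost exceptional with all? (λ b → c ≤? f b) A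
... | yes c≤f = ∑-≥-const c f A (λ _ → All.lookup c≤f)
... | no c≰f with find (¬All⇒Any¬ (λ b → c ≤? f b) A c≰f)
...   | b₀ , b₀∈A , c≰fb₀ = +-cancelʳ-≤ 1 _ _ (begin
  length A * c + 1                       ≤⟨ +-monoʳ-≤ (length A * c) (≤-length-without b₀ u 2≤|A|) ⟩
  length A * c + length (without b₀ A)   ≡⟨ cong₂ _+_ (sym (∑-const c A)) (sym (∑-δᶜ-length b₀ A)) ⟩
  ∑[ _ ∈ A ] c + ∑[ b ∈ A ] δᶜ b b₀      ≡⟨ sym (∑-distrib-+ A) ⟩
  ∑[ b ∈ A ] (c + δᶜ b b₀)               ≤⟨ ∑-mono-≤ A shifted ⟩
  ∑[ b ∈ A ] (f b + δ b b₀)              ≡⟨ ∑-distrib-+ A ⟩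
  ∑ A f + multiplicity A b₀              ≡⟨ cong (∑ A f +_) (trans (multiplicity-as-hit A b₀) (∑-δ-∈ b₀ _ A u b₀∈A)) ⟩
  ∑ A f + 1                              ∎)
  where
  open ≤-Reasoning
  shifted : ∀ b → b ∈ A → c + δᶜ b b₀ ≤ f b + δ b b₀
  shifted b b∈A with b ≟ b₀
  ... | yes refl = ≤-trans (≤-reflexive (+-identityʳ c)) (≤-trans (almost b∈A) (≤-reflexive (+-comm 1 (f b))))
  ... | no b≢b₀  = ≤-trans (≤-reflexive (+-comm c 1))
                     (≤-trans (exceptional b₀∈A (≰⇒> c≰fb₀) b∈A b≢b₀) (≤-reflexive (sym (+-identityʳ (f b)))))

module _ {b : ℕ} {L : List ℕ} {T₁ T₃ X : ℕ} where

  private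
    Φ₁ = 1 * 1 * T₃ + (1 + 2) * X

    Φ₁-≥ : ∀ k a e → k ≤ T₁ → 2 * (2 * T₁) + a ≤ T₃ → 1 * T₁ + e ≤ X → 7 * k + (a + 3 * e) ≤ Φ₁
    Φ₁-≥ k a e k≤T₁ T₃≥ X≥ = begin
      7 * k + (a + 3 * e)                   ≤⟨ +-monoˡ-≤ (a + 3 * e) (*-monoʳ-≤ 7 k≤T₁) ⟩
      7 * T₁ + (a + 3 * e)                  ≡⟨ identity T₁ a e ⟩
      2 * (2 * T₁) + a + 3 * (1 * T₁ + e)   ≤⟨ +-mono-≤ (≤-trans T₃≥ (≤-reflexive (sym (*-identityˡ T₃)))) (*-monoʳ-≤ 3 X≥) ⟩
      Φ₁                                    ∎
      where
      open ≤-Reasoning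
      identity : ∀ T a e → 7 * T + (a + 3 * e) ≡ 2 * (2 * T) + a + 3 * (1 * T + e)
      identity = solve-∀

    T₃-deficit : 2 * (2 * T₁ + 1) ≤ T₃ → 2 * (2 * T₁) + 2 ≤ T₃
    T₃-deficit = ≤-trans (≤-reflexive (sym (*-distribˡ-+ 2 (2 * T₁) 1)))

    T₃-plain : 2 * (2 * T₁) ≤ T₃ → 2 * (2 * T₁) + 0 ≤ T₃
    T₃-plain = ≤-trans (≤-reflexive (+-identityʳ _))

  33≤Φ₁ : TailCase 1 2 b L T₁ T₃ X → 33 ≤ Φ₁
  33≤Φ₁ (surplus 5≤T₁ T₃≥ X≥)   = ≤-trans (m≤m+n 33 5) (Φ₁-≥ 5 0 1 5≤T₁ (T₃-plain T₃≥) X≥)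
  33≤Φ₁ (tight 4≤T₁ T₃≥ X≥)     = ≤-trans (m≤m+n 33 1) (Φ₁-≥ 4 0 2 4≤T₁ (T₃-plain T₃≥) X≥)
  33≤Φ₁ (deficit _ 4≤T₁ T₃≥ X≥) = Φ₁-≥ 4 2 1 4≤T₁ (T₃-deficit T₃≥) X≥

  35≤Φ₁ : TailCase 1 2 b L T₁ T₃ X → 5 ≤ T₁ → 35 ≤ Φ₁
  35≤Φ₁ (surplus _ T₃≥ X≥)   5≤T₁ = ≤-trans (m≤m+n 35 3) (Φ₁-≥ 5 0 1 5≤T₁ (T₃-plain T₃≥) X≥)
  35≤Φ₁ (tight _ T₃≥ X≥)     5≤T₁ = ≤-trans (m≤m+n 35 6) (Φ₁-≥ 5 0 2 5≤T₁ (T₃-plain T₃≥) X≥)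
  35≤Φ₁ (deficit _ _ T₃≥ X≥) 5≤T₁ = ≤-trans (m≤m+n 35 5) (Φ₁-≥ 5 2 1 5≤T₁ (T₃-deficit T₃≥) X≥)

  Φ₁<34⇒∉ : TailCase 1 2 b L T₁ T₃ X → Φ₁ < 34 → b ∉ L
  Φ₁<34⇒∉ (surplus 5≤T₁ T₃≥ X≥) Φ₁<34 =
    contradiction (≤-trans (m≤m+n 34 4) (Φ₁-≥ 5 0 1 5≤T₁ (T₃-plain T₃≥) X≥)) (<⇒≱ Φ₁<34)
  Φ₁<34⇒∉ (tight 4≤T₁ T₃≥ X≥) Φ₁<34 = contradiction (Φ₁-≥ 4 0 2 4≤T₁ (T₃-plain T₃≥) X≥) (<⇒≱ Φ₁<34)
  Φ₁<34⇒∉ (deficit b∉L _ _ _) _    = b∉L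

-- A colour b₀ with Φ = 33 = Φᵤ - 1 lies in the list next to v but not in the one before it, and this forces Φ ≥ 35
-- for every other colour.
average-3-colours : ∀ A L₂ L₁ K → IsAssignment 3 (L₂ ∷ L₁ ∷ K ∷ []) → Unique A → length A ≡ 3 →
                    length A * Φᵤ 1 4 ≤ ∑[ b ∈ A ] Φ 1 b A (L₂ ∷ L₁ ∷ K ∷ [])
average-3-colours A L₂ L₁ K asg@((u₂ , |L₂|) , (u₁ , |L₁|) , (uK , |K|) , _) uA |A| =
  ∑-≥-average 34 (λ b → Φ 1 b A Lp) A uA (≤-trans (s≤s (s≤s z≤n)) (≤-reflexive (sym |A|)))
    (λ {b} _ → s≤s (33≤Φ₁ (tail b))) exceptional
  where
  Lp = L₂ ∷ L₁ ∷ K ∷ []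
  T₁ : ℕ → ℕ
  T₁ b = ∑ L₁ (extend K (λ x → δᶜ x b))
  tail : ∀ b → TailCase 1 2 b L₁ (T₁ b) (∑ A (paths b Lp)) (paths b Lp b)
  tail b = tailCase (pathBounds 0 b L₁ (K ∷ []) (proj₂ asg)) u₁ |L₁| u₂ |L₂| uA |A|
  exceptional : ∀ {b₀} → b₀ ∈ A → Φ 1 b₀ A Lp < 34 → ∀ {b} → b ∈ A → b ≢ b₀ → 35 ≤ Φ 1 b A Lp
  exceptional {b₀} _ Φb₀<34 {b} _ b≢b₀ = 35≤Φ₁ (tail b) (begin
    5                                 ≤⟨ +-mono-≤ (*-monoʳ-≤ 2 (PathBounds.total (pathBounds-base 0 b uK |K|)))
                                                  (≤-reflexive (sym (δᶜ-≢ (b≢b₀ ∘ sym)))) ⟩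
    2 * ∑[ x ∈ K ] δᶜ x b + δᶜ b₀ b   ≤⟨ ∑-extend-≥-miss 1 K (λ x → δᶜ x b) uK u₁ |L₁| b₀∈K b₀∉L₁ ⟩
    T₁ b                              ∎)
    where
    open ≤-Reasoning
    b₀∉L₁ : b₀ ∉ L₁
    b₀∉L₁ = Φ₁<34⇒∉ (tail b₀) Φb₀<34
    b₀∈K : b₀ ∈ K
    b₀∈K with b₀ ∈? K
    ... | yes b₀∈K = b₀∈K
    ... | no b₀∉K  = contradiction (35≤Φ₁ (tail b₀) 5≤T₁b₀) (<⇒≱ (m<n⇒m<1+n Φb₀<34))
      where
      5≤T₁b₀ : 5 ≤ T₁ b₀
      5≤T₁b₀ = ≤-trans (n≤1+n 5) (≤-trans
        (≤-reflexive (cong (2 *_) (sym (trans (∑-δᶜ-length b₀ K) (trans (cong length (without-∉ b₀∉K)) |K|)))))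
        (∑-extend-≥ 1 K (λ x → δᶜ x b₀) u₁ |L₁|))

-- Counting the colourings of Θ(2,2,l)

count : {A : Set} {P : A → Set} → Decidable P → List A → ℕ
count P? xs = length (filter P? xs)

count-∷ : {A : Set} {P : A → Set} (P? : Decidable P) → ∀ x xs → count P? (x ∷ xs) ≡ 𝟙 (P? x) + count P? xs
count-∷ P? x xs with P? x
... | yes _ = refl
... | no _  = refl

count-++ : {A : Set} {P : A → Set} (P? : Decidable P) → ∀ xs ys → count P? (xs ++ ys) ≡ count P? xs + count P? ys
count-++ P? xs ys = trans (cong length (filter-++ P? xs ys)) (length-++ (filter P? xs))

count-map : {A B : Set} {P : A → Set} (P? : Decidable P) (f : B → A) → ∀ xs → count P? (map f xs) ≡ count (P? ∘ f) xs
count-map P? f []       = refl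
count-map P? f (x ∷ xs) = trans (count-∷ P? (f x) (map f xs))
  (trans (cong (𝟙 (P? (f x)) +_) (count-map P? f xs)) (sym (count-∷ (P? ∘ f) x xs)))

count-cong : {A : Set} {P Q : A → Set} (P? : Decidable P) (Q? : Decidable Q) → ∀ xs →
             (∀ {x} → P x → Q x) → (∀ {x} → Q x → P x) → count P? xs ≡ count Q? xs
count-cong P? Q? []       _ _ = refl
count-cong P? Q? (x ∷ xs) f g = trans (count-∷ P? x xs)
  (trans (cong₂ _+_ (𝟙-cong (P? x) (Q? x) f g) (count-cong P? Q? xs f g)) (sym (count-∷ Q? x xs)))

count-×ˡ : {A R : Set} {S : A → Set} (R? : Dec R) (S? : Decidable S) → ∀ xs →
           count (λ x → R? ×-dec S? x) xs ≡ 𝟙 R? * count S? xs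
count-×ˡ R? S? []       = sym (*-zeroʳ (𝟙 R?))
count-×ˡ R? S? (x ∷ xs) = begin
  count (λ x → R? ×-dec S? x) (x ∷ xs)              ≡⟨ count-∷ (λ x → R? ×-dec S? x) x xs ⟩
  𝟙 (R? ×-dec S? x) + count (λ x → R? ×-dec S? x) xs ≡⟨ cong₂ _+_ (𝟙-× R? (S? x)) (count-×ˡ R? S? xs) ⟩
  𝟙 R? * 𝟙 (S? x) + 𝟙 R? * count S? xs              ≡⟨ sym (*-distribˡ-+ (𝟙 R?) _ _) ⟩
  𝟙 R? * (𝟙 (S? x) + count S? xs)                   ≡⟨ cong (𝟙 R? *_) (sym (count-∷ S? x xs)) ⟩
  𝟙 R? * count S? (x ∷ xs)                          ∎
  where open ≡-Reasoning

count-choices : ∀ {n} {P : Vec ℕ (suc n) → Set} (P? : Decidable P) → ∀ A (As : Vec (List ℕ) n) →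
                count P? (choices (A ∷ As)) ≡ ∑[ a ∈ A ] count (P? ∘ (a ∷_)) (choices As)
count-choices P? []      As = refl
count-choices P? (a ∷ A) As = trans (count-++ P? (map (a ∷_) (choices As)) _)
  (cong₂ _+_ (count-map P? (a ∷_) (choices As)) (count-choices P? A As))

PathOK : ℕ → ∀ {n} → Vec ℕ n → ℕ → Set
PathOK a []       b = a ≢ b
PathOK a (x ∷ xs) b = a ≢ x × PathOK x xs b

pathOK? : ∀ a {n} (p : Vec ℕ n) b → Dec (PathOK a p b)
pathOK? a []       b = ¬? (a ≟ b)
pathOK? a (x ∷ xs) b = ¬? (a ≟ x) ×-dec pathOK? x xs b

count-pathOK : ∀ {t} (Ls : Vec (List ℕ) t) a b → count (λ p → pathOK? a p b) (choices Ls) ≡ paths b Ls a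
count-pathOK []       a b = trans (count-∷ (λ p → pathOK? a p b) [] []) (+-identityʳ (δᶜ a b))
count-pathOK (L ∷ Ls) a b = trans (count-choices (λ p → pathOK? a p b) L Ls) (∑-cong L (λ x _ →
  trans (count-×ˡ (¬? (a ≟ x)) (λ p → pathOK? x p b) (choices Ls)) (cong (δᶜ a x *_) (count-pathOK Ls x b))))

ProperEdge : ∀ {n} → Vec ℕ n → ℕ × ℕ → Set
ProperEdge c (i , j) = at c i ≢ at c j

module _ {n} (x : ℕ) (v : Vec ℕ n) where

  chain-suc⁻ : ∀ s j → All (ProperEdge (x ∷ v)) (chain (suc s) j) → All (ProperEdge v) (chain s j)
  chain-suc⁻ s zero    []         = []
  chain-suc⁻ s (suc j) (ok ∷ oks) = ok ∷ chain-suc⁻ (suc s) j oks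

  chain-suc⁺ : ∀ s j → All (ProperEdge v) (chain s j) → All (ProperEdge (x ∷ v)) (chain (suc s) j)
  chain-suc⁺ s zero    []         = []
  chain-suc⁺ s (suc j) (ok ∷ oks) = ok ∷ chain-suc⁺ (suc s) j oks

chain-shift⁻ : ∀ {k n} (w : Vec ℕ k) (v : Vec ℕ n) s j →
               All (ProperEdge (w V.++ v)) (chain (k + s) j) → All (ProperEdge v) (chain s j)
chain-shift⁻ []      v s j oks = oks
chain-shift⁻ (x ∷ w) v s j oks = chain-shift⁻ w v s j (chain-suc⁻ x (w V.++ v) _ j oks)

chain-shift⁺ : ∀ {k n} (w : Vec ℕ k) (v : Vec ℕ n) s j →
               All (ProperEdge v) (chain s j) → All (ProperEdge (w V.++ v)) (chain (k + s) j)
chain-shift⁺ []      v s j oks = oks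
chain-shift⁺ (x ∷ w) v s j oks = chain-suc⁺ x (w V.++ v) _ j (chain-shift⁺ w v s j oks)

pathOK⇒ : ∀ n a b (p : Vec ℕ (suc n)) → PathOK a p b → a ≢ at p 0 × All (ProperEdge p) (chain 0 n) × at p n ≢ b
pathOK⇒ zero    a b (x ∷ []) (a≢x , x≢b) = a≢x , [] , x≢b
pathOK⇒ (suc n) a b (x ∷ p)  (a≢x , ok) with pathOK⇒ n x b p ok
... | x≢p₀ , oks , pₙ≢b = a≢x , x≢p₀ ∷ chain-suc⁺ x p 0 n oks , pₙ≢b

pathOK⇐ : ∀ n a b (p : Vec ℕ (suc n)) → a ≢ at p 0 × All (ProperEdge p) (chain 0 n) × at p n ≢ b → PathOK a p b
pathOK⇐ zero    a b (x ∷ []) (a≢x , [] , x≢b)          = a≢x , x≢b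
pathOK⇐ (suc n) a b (x ∷ p)  (a≢x , x≢p₀ ∷ oks , pₙ≢b) = a≢x , pathOK⇐ n x b p (x≢p₀ , chain-suc⁻ x p 0 n oks , pₙ≢b)

Avoids : ℕ → ℕ → ℕ → Set
Avoids a b c = a ≢ c × c ≢ b

avoids? : ∀ a b c → Dec (Avoids a b c)
avoids? a b c = ¬? (a ≟ c) ×-dec ¬? (c ≟ b)

ThetaOK : ℕ → ℕ → ℕ → ℕ → ∀ {n} → Vec ℕ n → Set
ThetaOK a b c₂ c₃ p = Avoids a b c₂ × Avoids a b c₃ × PathOK a p b

thetaOK? : ∀ a b c₂ c₃ {n} (p : Vec ℕ n) → Dec (ThetaOK a b c₂ c₃ p)
thetaOK? a b c₂ c₃ p = avoids? a b c₂ ×-dec avoids? a b c₃ ×-dec pathOK? a p b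

module _ {n a b c₂ c₃ : ℕ} {p : Vec ℕ (suc n)} where

  proper⇒thetaOK : Proper (edges (Θ 2 2 (suc (suc n)))) (a ∷ b ∷ c₂ ∷ c₃ ∷ p) → ThetaOK a b c₂ c₃ p
  proper⇒thetaOK (a≢c₂ ∷ c₂≢b ∷ a≢c₃ ∷ c₃≢b ∷ a≢p₀ ∷ rest) with ++⁻ (chain 4 n) rest
  ... | oks , pₙ≢b ∷ [] = (a≢c₂ , c₂≢b) , (a≢c₃ , c₃≢b) ,
                          pathOK⇐ n a b p (a≢p₀ , chain-shift⁻ (a ∷ b ∷ c₂ ∷ c₃ ∷ []) p 0 n oks , pₙ≢b)

  thetaOK⇒proper : ThetaOK a b c₂ c₃ p → Proper (edges (Θ 2 2 (suc (suc n)))) (a ∷ b ∷ c₂ ∷ c₃ ∷ p)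
  thetaOK⇒proper ((a≢c₂ , c₂≢b) , (a≢c₃ , c₃≢b) , ok) with pathOK⇒ n a b p ok
  ... | a≢p₀ , oks , pₙ≢b = a≢c₂ ∷ c₂≢b ∷ a≢c₃ ∷ c₃≢b ∷ a≢p₀ ∷
                            ++⁺ (chain-shift⁺ (a ∷ b ∷ c₂ ∷ c₃ ∷ []) p 0 n oks) (pₙ≢b ∷ [])

avoiding : List ℕ → ℕ → ℕ → ℕ
avoiding L a b = ∑[ c ∈ L ] 𝟙 (avoids? a b c)

PL-Θ₂₂ : ∀ n (L₀ L₁ L₂ L₃ : List ℕ) (Lp : Vec (List ℕ) (suc n)) →
        PL (Θ 2 2 (suc (suc n))) (L₀ ∷ L₁ ∷ L₂ ∷ L₃ ∷ Lp)
          ≡ ∑[ a ∈ L₀ ] ∑[ b ∈ L₁ ] (avoiding L₂ a b * (avoiding L₃ a b * paths b Lp a))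
PL-Θ₂₂ n L₀ L₁ L₂ L₃ Lp =
  trans (count-choices proper?Θ L₀ (L₁ ∷ L₂ ∷ L₃ ∷ Lp)) (∑-cong L₀ (λ a _ →
  trans (count-choices (λ v → proper?Θ (a ∷ v)) L₁ (L₂ ∷ L₃ ∷ Lp)) (∑-cong L₁ (λ b _ → with-ends a b))))
  where
  proper?Θ = proper? (edges (Θ 2 2 (suc (suc n))))
  with-middles : ∀ a b c₂ c₃ → count (λ p → proper?Θ (a ∷ b ∷ c₂ ∷ c₃ ∷ p)) (choices Lp)
                               ≡ 𝟙 (avoids? a b c₂) * (𝟙 (avoids? a b c₃) * paths b Lp a)
  with-middles a b c₂ c₃ = begin
    count (λ p → proper?Θ (a ∷ b ∷ c₂ ∷ c₃ ∷ p)) (choices Lp)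
      ≡⟨ count-cong (λ p → proper?Θ (a ∷ b ∷ c₂ ∷ c₃ ∷ p)) (thetaOK? a b c₂ c₃) (choices Lp)
                    proper⇒thetaOK thetaOK⇒proper ⟩
    count (thetaOK? a b c₂ c₃) (choices Lp)
      ≡⟨ count-×ˡ (avoids? a b c₂) (λ p → avoids? a b c₃ ×-dec pathOK? a p b) (choices Lp) ⟩
    𝟙 (avoids? a b c₂) * count (λ p → avoids? a b c₃ ×-dec pathOK? a p b) (choices Lp)
      ≡⟨ cong (𝟙 (avoids? a b c₂) *_) (count-×ˡ (avoids? a b c₃) (λ p → pathOK? a p b) (choices Lp)) ⟩
    𝟙 (avoids? a b c₂) * (𝟙 (avoids? a b c₃) * count (λ p → pathOK? a p b) (choices Lp))
      ≡⟨ cong (λ x → 𝟙 (avoids? a b c₂) * (𝟙 (avoids? a b c₃) * x)) (count-pathOK Lp a b) ⟩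
    𝟙 (avoids? a b c₂) * (𝟙 (avoids? a b c₃) * paths b Lp a) ∎
    where open ≡-Reasoning
  with-ends : ∀ a b → count (λ v → proper?Θ (a ∷ b ∷ v)) (choices (L₂ ∷ L₃ ∷ Lp))
                      ≡ avoiding L₂ a b * (avoiding L₃ a b * paths b Lp a)
  with-ends a b = begin
    count (λ v → proper?Θ (a ∷ b ∷ v)) (choices (L₂ ∷ L₃ ∷ Lp))
      ≡⟨ count-choices (λ v → proper?Θ (a ∷ b ∷ v)) L₂ (L₃ ∷ Lp) ⟩
    ∑[ c₂ ∈ L₂ ] count (λ v → proper?Θ (a ∷ b ∷ c₂ ∷ v)) (choices (L₃ ∷ Lp))
      ≡⟨ ∑-cong L₂ (λ c₂ _ → trans (count-choices (λ v → proper?Θ (a ∷ b ∷ c₂ ∷ v)) L₃ Lp)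
                                    (∑-cong L₃ (λ c₃ _ → with-middles a b c₂ c₃))) ⟩
    ∑[ c₂ ∈ L₂ ] ∑[ c₃ ∈ L₃ ] (𝟙 (avoids? a b c₂) * (𝟙 (avoids? a b c₃) * H))
      ≡⟨ ∑-cong L₂ (λ c₂ _ → trans (∑-*ˡ (𝟙 (avoids? a b c₂)) (λ c₃ → 𝟙 (avoids? a b c₃) * H) L₃)
                                    (cong (𝟙 (avoids? a b c₂) *_) (∑-*ʳ H (λ c₃ → 𝟙 (avoids? a b c₃)) L₃))) ⟩
    ∑[ c₂ ∈ L₂ ] (𝟙 (avoids? a b c₂) * (avoiding L₃ a b * H))
      ≡⟨ ∑-*ʳ (avoiding L₃ a b * H) (λ c₂ → 𝟙 (avoids? a b c₂)) L₂ ⟩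
    avoiding L₂ a b * (avoiding L₃ a b * H) ∎
    where
    open ≡-Reasoning
    H = paths b Lp a

-- Comparison with the uniform assignment

avoiding-length : ∀ L a b → avoiding L a b ≡ length (without b (without a L))
avoiding-length L a b = begin
  ∑[ c ∈ L ] 𝟙 (avoids? a b c)              ≡⟨ ∑-cong L (λ c _ → pointwise c) ⟩
  ∑[ c ∈ L ] (δᶜ a c * (δᶜ b c * 1))        ≡⟨ ∑-δᶜ a (λ c → δᶜ b c * 1) L ⟩
  ∑[ c ∈ without a L ] (δᶜ b c * 1)         ≡⟨ ∑-δᶜ b (λ _ → 1) (without a L) ⟩
  ∑[ _ ∈ without b (without a L) ] 1        ≡⟨ ∑-const 1 (without b (without a L)) ⟩
  length (without b (without a L)) * 1      ≡⟨ *-identityʳ _ ⟩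
  length (without b (without a L))          ∎
  where
  open ≡-Reasoning
  pointwise : ∀ c → 𝟙 (avoids? a b c) ≡ δᶜ a c * (δᶜ b c * 1)
  pointwise c = trans (𝟙-× (¬? (a ≟ c)) (¬? (c ≟ b)))
                      (cong (δᶜ a c *_) (trans (δᶜ-sym c b) (sym (*-identityʳ (δᶜ b c)))))

module _ {q : ℕ} {L : List ℕ} (u : Unique L) (|L| : length L ≡ suc (suc q)) where

  avoiding-≥ : ∀ a b → q + δ a b ≤ avoiding L a b
  avoiding-≥ a b with a ≟ b
  ... | yes refl rewrite avoiding-length L a a | without-∉ {a} {without a L} (λ a∈ → proj₂ (∈-without⁻ L a∈) refl) =
    ≤-trans (≤-reflexive (+-comm q 1)) (≤-length-without a u (≤-reflexive (sym |L|)))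
  ... | no _ rewrite avoiding-length L a b =
    ≤-trans (≤-reflexive (+-identityʳ q))
            (≤-length-without b (without-unique a u) (≤-length-without a u (≤-reflexive (sym |L|))))

  avoiding-exact : ∀ {a b} → a ∈ L → b ∈ L → avoiding L a b ≡ q + δ a b
  avoiding-exact {a} {b} a∈L b∈L with a ≟ b
  ... | yes refl rewrite avoiding-length L a a | without-∉ {a} {without a L} (λ a∈ → proj₂ (∈-without⁻ L a∈) refl) =
    suc-injective (trans (sym (length-without-∈ L u a∈L)) (trans |L| (cong suc (+-comm 1 q))))
  ... | no a≢b rewrite avoiding-length L a b = trans (suc-injective (suc-injective (begin
    suc (suc (length (without b (without a L))))
      ≡⟨ cong suc (sym (length-without-∈ (without a L) (without-unique a u) (∈-without⁺ b∈L a≢b))) ⟩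
    suc (length (without a L))                    ≡⟨ sym (length-without-∈ L u a∈L) ⟩
    length L                                      ≡⟨ |L| ⟩
    suc (suc q)                                   ∎))) (sym (+-identityʳ q))
    where open ≡-Reasoning

weight : ℕ → ℕ → ℕ → ℕ
weight q a b = q * q + (q + suc q) * δ a b

weight-square : ∀ q a b → (q + δ a b) * (q + δ a b) ≡ weight q a b
weight-square q a b with a ≟ b
... | yes _ = identity q
  where
  identity : ∀ q → (q + 1) * (q + 1) ≡ q * q + (q + suc q) * 1
  identity = solve-∀
... | no _  = identity q
  where
  identity : ∀ q → (q + 0) * (q + 0) ≡ q * q + (q + suc q) * 0
  identity = solve-∀

∑-weighted : ∀ q {t} A (Ls : Vec (List ℕ) t) b → Unique A → b ∈ A →
             ∑[ a ∈ A ] (weight q a b * paths b Ls a) ≡ Φ q b A Ls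
∑-weighted q A Ls b u b∈A = begin
  ∑[ a ∈ A ] (weight q a b * H a)                                  ≡⟨ ∑-cong A (λ a _ → expand a) ⟩
  ∑[ a ∈ A ] (q * q * H a + (q + suc q) * (δ b a * H a))           ≡⟨ ∑-distrib-+ A ⟩
  ∑[ a ∈ A ] (q * q * H a) + ∑[ a ∈ A ] ((q + suc q) * (δ b a * H a))
    ≡⟨ cong₂ _+_ (∑-*ˡ (q * q) H A)
                 (trans (∑-*ˡ (q + suc q) (λ a → δ b a * H a) A) (cong ((q + suc q) *_) (∑-δ-∈ b H A u b∈A))) ⟩
  Φ q b A Ls                                                       ∎
  where
  open ≡-Reasoning
  H = paths b Ls
  expand : ∀ a → weight q a b * H a ≡ q * q * H a + (q + suc q) * (δ b a * H a)
  expand a = trans (*-distribʳ-+ (H a) (q * q) _)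
    (cong (q * q * H a +_) (trans (*-assoc (q + suc q) (δ a b) (H a)) (cong (λ x → (q + suc q) * (x * H a)) (δ-sym a b))))

∑∑-weighted : ∀ q {t} A (Ls : Vec (List ℕ) t) → Unique A →
              ∑[ a ∈ A ] ∑[ b ∈ A ] (weight q a b * paths b Ls a) ≡ ∑[ b ∈ A ] Φ q b A Ls
∑∑-weighted q A Ls u =
  trans (∑-comm (λ a b → weight q a b * paths b Ls a) A A) (∑-cong A (λ b b∈A → ∑-weighted q A Ls b u b∈A))

module _ {q : ℕ} {C : List ℕ} (u : Unique C) (|C| : length C ≡ suc (suc q)) where

  paths-uniform : ∀ t {a b} → a ∈ C → b ∈ C → paths b (replicate t C) a ≡ δ a b * s q (suc t) + δᶜ a b * d q (suc t)
  paths-uniform zero {a} {b} _ _ = identity (δ a b) (δᶜ a b) q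
    where
    identity : ∀ e f q → f ≡ e * (suc q * 0) + f * (1 + q * 0)
    identity = solve-∀
  paths-uniform (suc t) {a} {b} a∈C b∈C = begin
    ∑[ y ∈ C ] (δᶜ a y * paths b (replicate t C) y)
      ≡⟨ ∑-cong C (λ y y∈C → trans (cong (δᶜ a y *_) (paths-uniform t y∈C b∈C))
                                   (spread (δᶜ a y) (δ y b) (δᶜ y b) S D)) ⟩
    ∑[ y ∈ C ] (S * (δᶜ a y * δ y b) + D * (δᶜ a y * δᶜ y b))
      ≡⟨ ∑-distrib-+ C ⟩
    ∑[ y ∈ C ] (S * (δᶜ a y * δ y b)) + ∑[ y ∈ C ] (D * (δᶜ a y * δᶜ y b))
      ≡⟨ cong₂ _+_ (trans (∑-*ˡ S _ C) (cong (S *_) through-b)) (trans (∑-*ˡ D _ C) (cong (D *_) avoiding-a-b)) ⟩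
    S * δᶜ a b + D * (q + δ a b)
      ≡⟨ recombine ⟩
    δ a b * s q (suc (suc t)) + δᶜ a b * d q (suc (suc t)) ∎
    where
    open ≡-Reasoning
    S = s q (suc t)
    D = d q (suc t)
    spread : ∀ x e f S D → x * (e * S + f * D) ≡ S * (x * e) + D * (x * f)
    spread = solve-∀
    through-b : ∑[ y ∈ C ] (δᶜ a y * δ y b) ≡ δᶜ a b
    through-b = trans (∑-cong C (λ y _ → trans (*-comm (δᶜ a y) _) (cong (_* δᶜ a y) (δ-sym y b))))
                      (∑-δ-∈ b (δᶜ a) C u b∈C)
    avoiding-a-b : ∑[ y ∈ C ] (δᶜ a y * δᶜ y b) ≡ q + δ a b
    avoiding-a-b = trans (sym (∑-cong C (λ y _ → 𝟙-× (¬? (a ≟ y)) (¬? (y ≟ b))))) (avoiding-exact u |C| a∈C b∈C)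
    recombine : S * δᶜ a b + D * (q + δ a b) ≡ δ a b * s q (suc (suc t)) + δᶜ a b * d q (suc (suc t))
    recombine with a ≟ b
    ... | yes _ = identity S D q
      where
      identity : ∀ S D q → S * 0 + D * (q + 1) ≡ 1 * (suc q * D) + 0 * (S + q * D)
      identity = solve-∀
    ... | no _  = identity S D q
      where
      identity : ∀ S D q → S * 1 + D * (q + 0) ≡ 0 * (suc q * D) + 1 * (S + q * D)
      identity = solve-∀

  Φ-uniform : ∀ t {b} → b ∈ C → Φ q b C (replicate t C) ≡ Φᵤ q (suc t)
  Φ-uniform t {b} b∈C = cong₂ (λ x y → q * q * x + (q + suc q) * y) total diagonal
    where
    S = s q (suc t)
    D = d q (suc t)
    diagonal : paths b (replicate t C) b ≡ S
    diagonal = trans (paths-uniform t b∈C b∈C)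
      (trans (cong₂ (λ x y → x * S + y * D) (δ-refl b) (δᶜ-refl b)) (trans (+-identityʳ (1 * S)) (*-identityˡ S)))
    total : ∑ C (paths b (replicate t C)) ≡ U q (suc t)
    total = begin
      ∑[ a ∈ C ] paths b (replicate t C) a            ≡⟨ ∑-cong C (λ a a∈C → paths-uniform t a∈C b∈C) ⟩
      ∑[ a ∈ C ] (δ a b * S + δᶜ a b * D)             ≡⟨ ∑-distrib-+ C ⟩
      ∑[ a ∈ C ] (δ a b * S) + ∑[ a ∈ C ] (δᶜ a b * D)
        ≡⟨ cong₂ _+_ (trans (∑-cong C (λ a _ → cong (_* S) (δ-sym a b))) (∑-δ-∈ b (λ _ → S) C u b∈C))
                     (trans (∑-cong C (λ a _ → cong (_* D) (δᶜ-sym a b))) (∑-δᶜ b (λ _ → D) C)) ⟩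
      S + ∑[ _ ∈ without b C ] D                      ≡⟨ cong (S +_) (∑-const D (without b C)) ⟩
      S + length (without b C) * D
        ≡⟨ cong (λ x → S + x * D) (suc-injective (trans (sym (length-without-∈ C u b∈C)) |C|)) ⟩
      U q (suc t)                                     ∎
      where open ≡-Reasoning

P-Θ₂₂-uniform : ∀ n r → P (Θ 2 2 (suc (suc r))) (suc (suc (suc n))) ≡ suc (suc (suc n)) * Φᵤ (suc n) (2 + r)
P-Θ₂₂-uniform n r = begin
  P (Θ 2 2 (suc (suc r))) m
    ≡⟨ PL-Θ₂₂ r C C C C Lu ⟩
  ∑[ a ∈ C ] ∑[ b ∈ C ] (avoiding C a b * (avoiding C a b * paths b Lu a))
    ≡⟨ ∑-cong C (λ a a∈C → ∑-cong C (λ b b∈C → square a∈C b∈C)) ⟩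
  ∑[ a ∈ C ] ∑[ b ∈ C ] (weight q a b * paths b Lu a)
    ≡⟨ ∑∑-weighted q C Lu uC ⟩
  ∑[ b ∈ C ] Φ q b C Lu
    ≡⟨ ∑-cong C (λ b b∈C → Φ-uniform uC |C| (suc r) b∈C) ⟩
  ∑[ _ ∈ C ] Φᵤ q (2 + r)
    ≡⟨ ∑-const (Φᵤ q (2 + r)) C ⟩
  length C * Φᵤ q (2 + r)
    ≡⟨ cong (_* Φᵤ q (2 + r)) |C| ⟩
  m * Φᵤ q (2 + r) ∎
  where
  open ≡-Reasoning
  q = suc n
  m = suc (suc q)
  C = upTo m
  uC = upTo⁺ m
  |C| = length-upTo m
  Lu = replicate (suc r) C
  square : ∀ {a b} → a ∈ C → b ∈ C → avoiding C a b * (avoiding C a b * paths b Lu a) ≡ weight q a b * paths b Lu a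
  square {a} {b} a∈C b∈C = trans (sym (*-assoc (avoiding C a b) _ _))
    (cong (_* paths b Lu a) (trans (cong (λ x → x * x) (avoiding-exact uC |C| a∈C b∈C)) (weight-square q a b)))

∑-SameSet : ∀ (f : ℕ → ℕ) {L₀ L₁} → Unique L₀ → Unique L₁ → SameSet L₀ L₁ → ∑ L₁ f ≡ ∑ L₀ f
∑-SameSet f {L₀} {L₁} u₀ u₁ (L₀⊆L₁ , L₁⊆L₀) = begin
  ∑[ y ∈ L₁ ] f y                                ≡⟨ ∑-cong L₁ (λ y y∈L₁ → sym (∑-δ-∈ y f L₀ u₀ (L₁⊆L₀ y y∈L₁))) ⟩
  ∑[ y ∈ L₁ ] ∑[ x ∈ L₀ ] (δ y x * f x)          ≡⟨ ∑-comm (λ y x → δ y x * f x) L₁ L₀ ⟩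
  ∑[ x ∈ L₀ ] ∑[ y ∈ L₁ ] (δ y x * f x)          ≡⟨ ∑-cong L₀ (λ x x∈L₀ → trans (∑-*ʳ (f x) _ L₁) (once x x∈L₀)) ⟩
  ∑[ x ∈ L₀ ] f x                                ∎
  where
  open ≡-Reasoning
  once : ∀ x → x ∈ L₀ → multiplicity L₁ x * f x ≡ f x
  once x x∈L₀ =
    trans (cong (_* f x) (trans (multiplicity-as-hit L₁ x) (∑-δ-∈ x _ L₁ u₁ (L₀⊆L₁ x x∈L₀)))) (*-identityˡ (f x))

∑Φ≤PL : ∀ n r (L₀ L₁ L₂ L₃ : List ℕ) (Lp : Vec (List ℕ) (suc r)) → Unique L₀ → Unique L₁ → SameSet L₀ L₁ →
        Unique L₂ → length L₂ ≡ suc (suc (suc n)) → Unique L₃ → length L₃ ≡ suc (suc (suc n)) →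
        ∑[ b ∈ L₀ ] Φ (suc n) b L₀ Lp ≤ PL (Θ 2 2 (suc (suc r))) (L₀ ∷ L₁ ∷ L₂ ∷ L₃ ∷ Lp)
∑Φ≤PL n r L₀ L₁ L₂ L₃ Lp u₀ u₁ L₀≈L₁ u₂ |L₂| u₃ |L₃| = begin
  ∑[ b ∈ L₀ ] Φ q b L₀ Lp
    ≡⟨ sym (∑∑-weighted q L₀ Lp u₀) ⟩
  ∑[ a ∈ L₀ ] ∑[ b ∈ L₀ ] (weight q a b * paths b Lp a)
    ≡⟨ ∑-cong L₀ (λ a _ → sym (∑-SameSet (λ b → weight q a b * paths b Lp a) u₀ u₁ L₀≈L₁)) ⟩
  ∑[ a ∈ L₀ ] ∑[ b ∈ L₁ ] (weight q a b * paths b Lp a)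
    ≤⟨ ∑-mono-≤ L₀ (λ a _ → ∑-mono-≤ L₁ (λ b _ → pointwise a b)) ⟩
  ∑[ a ∈ L₀ ] ∑[ b ∈ L₁ ] (avoiding L₂ a b * (avoiding L₃ a b * paths b Lp a))
    ≡⟨ sym (PL-Θ₂₂ r L₀ L₁ L₂ L₃ Lp) ⟩
  PL (Θ 2 2 (suc (suc r))) (L₀ ∷ L₁ ∷ L₂ ∷ L₃ ∷ Lp) ∎
  where
  open ≤-Reasoning
  q = suc n
  pointwise : ∀ a b → weight q a b * paths b Lp a ≤ avoiding L₂ a b * (avoiding L₃ a b * paths b Lp a)
  pointwise a b = ≤-trans
    (*-monoˡ-≤ (paths b Lp a) (≤-trans (≤-reflexive (sym (weight-square q a b)))
       (*-mono-≤ (avoiding-≥ u₂ |L₂| a b) (avoiding-≥ u₃ |L₃| a b))))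
    (≤-reflexive (*-assoc (avoiding L₂ a b) _ _))

|A|*Φᵤ≤∑Φ : ∀ n j {r} → r ≡ 2 * suc j → (A : List ℕ) (Lp : Vec (List ℕ) (suc r)) →
             IsAssignment (suc (suc (suc n))) Lp → Unique A → length A ≡ suc (suc (suc n)) →
             length A * Φᵤ (suc n) (2 + r) ≤ ∑[ b ∈ A ] Φ (suc n) b A Lp
|A|*Φᵤ≤∑Φ zero zero refl A (L₂ ∷ L₁ ∷ K ∷ []) asg uA |A| = average-3-colours A L₂ L₁ K asg uA |A|
|A|*Φᵤ≤∑Φ (suc n) j refl A (L₂ ∷ L₁ ∷ rest) asg uA |A| =
  ∑-≥-const _ _ A (λ b _ → Φᵤ≤Φ (suc n) b A L₂ L₁ rest asg uA |A| (even-profile (suc (suc n)) (suc j))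
    (deficit-affordable (suc n) _ (d-pos (suc n) t) (inj₁ (s≤s z≤n))))
  where t = j + suc (j + 0)
|A|*Φᵤ≤∑Φ zero (suc j) refl A (L₂ ∷ L₁ ∷ rest) asg uA |A| =
  ∑-≥-const _ _ A (λ b _ → Φᵤ≤Φ zero b A L₂ L₁ rest asg uA |A| (even-profile 1 (suc (suc j)))
    (deficit-affordable zero _ (d-pos zero t) (inj₂ (2≤d zero (≤-trans (s≤s z≤n) (m≤n+m _ j))))))
  where t = suc j + suc (suc j + 0)

mainTheorem9 : (k m : ℕ) → 2 ≤ k → 3 ≤ m →
    (L : Vec (List ℕ) (thetaN 2 2 (2 * k))) → IsAssignment m L →
    SameSet (lookup L zero) (lookup L (suc zero)) →
    P (Θ 2 2 (2 * k)) m ≤ PL (Θ 2 2 (2 * k)) L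
mainTheorem9 (suc (suc j)) (suc (suc (suc n))) (s≤s (s≤s z≤n)) (s≤s (s≤s (s≤s z≤n)))
             L@(L₀ ∷ L₁ ∷ L₂ ∷ L₃ ∷ Lp) ((u₀ , |L₀|) , (u₁ , _) , (u₂ , |L₂|) , (u₃ , |L₃|) , asg) L₀≈L₁ = begin
  P (Θ 2 2 (2 * k)) m               ≡⟨ P-Θ₂₂-uniform n r ⟩
  m * Φᵤ (suc n) (2 + r)            ≡⟨ cong (_* Φᵤ (suc n) (2 + r)) (sym |L₀|) ⟩
  length L₀ * Φᵤ (suc n) (2 + r)    ≤⟨ |A|*Φᵤ≤∑Φ n j (+-suc j (suc (j + 0))) L₀ Lp asg u₀ |L₀| ⟩
  ∑[ b ∈ L₀ ] Φ (suc n) b L₀ Lp     ≤⟨ ∑Φ≤PL n r L₀ L₁ L₂ L₃ Lp u₀ u₁ L₀≈L₁ u₂ |L₂| u₃ |L₃| ⟩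
  PL (Θ 2 2 (2 * k)) L              ∎
  where
  open ≤-Reasoning
  k = suc (suc j)
  m = suc (suc (suc n))
  r = j + suc (suc (j + 0))
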